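{- Let $G=(V,E)$ be a graph with shortest cycle length $\ell$, and let $C\subseteq E$ be the edge set of a cycle of length in $[\ell,1.01\ell]$. Let $G/C$ be the graph obtained by contracting all edges of $C$. Then every cycle of $G/C$ has length at least $0.2\ell$.
   Context: Contracting $C$ means identifying all vertices of the cycle $C$ into a single vertex and removing the edges of $C$; all other edges are kept (possibly becoming loops or parallel edges, which count as cycles of length 1 and 2 respectively). Equivalently, a set $C'\subseteq E\setminus C$ contains a cycle of $G/C$ iff $C'\cup C$ contains a cycle of $G$ other than $C$. -}

module Defs where

open import Data.Nat using (ℕ; zero; suc; _≤_)
open import Data.Fin using (Fin; zero; suc; inject₁; fromℕ)
open import Data.Fin.Subset using (Subset; _∈_; _∉_)
open import Data.Product using (_×_; _,_; proj₁; proj₂; ∃; ∃-syntax; Σ)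
open import Data.Sum using (_⊎_)
open import Relation.Binary.PropositionalEquality using (_≡_; _≢_)
open import Relation.Nullary using (¬_)
open import Function.Definitions using (Injective)

record Graph (n m : ℕ) : Set where
  field
    ends : Fin m → Fin n × Fin n

open Graph public

Joins : ∀ {n m} → Graph n m → Fin m → Fin n → Fin n → Set
Joins G e u v = ends G e ≡ (u , v) ⊎ ends G e ≡ (v , u)

Simple : ∀ {n m} → Graph n m → Set
Simple G = (∀ e → proj₁ (ends G e) ≢ proj₂ (ends G e))
         × (∀ e e' → Joins G e' (proj₁ (ends G e)) (proj₂ (ends G e)) → e ≡ e')

record Cycle {n m : ℕ} (G : Graph n m) : Set where
  field
    k     : ℕ
    vtx   : Fin (suc k) → Fin n
    edg   : Fin (suc k) → Fin m
    vtx-inj : Injective _≡_ _≡_ vtx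
    edg-inj : Injective _≡_ _≡_ edg
    step  : ∀ (i : Fin k) → Joins G (edg (inject₁ i)) (vtx (inject₁ i)) (vtx (suc i))
    close : Joins G (edg (fromℕ k)) (vtx (fromℕ k)) (vtx zero)

open Cycle public

len : ∀ {n m} {G : Graph n m} → Cycle G → ℕ
len c = suc (k c)

InCycle : ∀ {n m} {G : Graph n m} → Cycle G → Fin m → Set
InCycle c e = ∃[ i ] edg c i ≡ e

SameEdges : ∀ {n m} {G : Graph n m} → Cycle G → Cycle G → Set
SameEdges c d = ∀ e → (InCycle c e → InCycle d e) × (InCycle d e → InCycle c e)

IsGirth : ∀ {n m} → Graph n m → ℕ → Set
IsGirth G ℓ = (Σ (Cycle G) λ c → len c ≡ ℓ) × (∀ (c : Cycle G) → ℓ ≤ len c)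

-- S ⊆ E∖C contains a cycle of G/C  iff  S ∪ C contains a cycle of G other than C
ContainsCycleContr : ∀ {n m} {G : Graph n m} → Cycle G → Subset m → Set
ContainsCycleContr {G = G} C S =
  Σ (Cycle G) λ D → ¬ SameEdges D C × (∀ e → InCycle D e → e ∈ S ⊎ InCycle C e)

-- S is (the edge set of) a cycle of G/C: a minimal edge set of E∖C containing a cycle of G/C
IsCycleOfContr : ∀ {n m} {G : Graph n m} → Cycle G → Subset m → Set
IsCycleOfContr {m = m} C S =
  (∀ e → e ∈ S → ¬ InCycle C e)
  × ContainsCycleContr C S
  × (∀ (S' : Subset m) → (∀ e → e ∈ S' → e ∈ S) → ContainsCycleContr C S' → ∀ e → e ∈ S → e ∈ S')

{-# OPTIONS --safe #-}
-- Let D be a cycle of G, other than C, with all its edges in S ∪ C. In a loopless graph the edge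
-- set of a cycle is never a proper subset of that of another cycle, so D has an edge off C. If D
-- never meets C, then ℓ ≤ |D| ≤ |S|. Otherwise D contains a detour: q consecutive edges of D off C
-- (hence in S) whose inner vertices avoid C and whose two ends lie on C. Either the detour is all
-- of D, and ℓ ≤ q, or its ends differ and closing it up with each of the two arcs of C between
-- them gives two cycles, so 2ℓ ≤ 2q + |C| ≤ 2q + 1.01ℓ, whence ℓ ≤ 2q / 0.99 ≤ 5q.
module Submission where

open import Defs
open import Data.Nat using (ℕ; _≤_; _*_)
open import Data.Fin.Subset using (Subset; ∣_∣)

open import Data.Nat.Base using (zero; suc; _+_; _∸_; _<_; z≤n; s≤s; z<s; NonZero)
open import Data.Nat.Properties
open import Data.Nat.DivMod
open import Data.Nat.Divisibility using (_∣_; n∣m*n; ∣m+n∣m⇒∣n; >⇒∤)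
open import Data.Nat.Tactic.RingSolver using (solve)
open import Data.Fin.Base as Fin using (Fin; toℕ; inject₁; fromℕ; fromℕ<)
open import Data.Fin.Properties
  using (toℕ-injective; toℕ-fromℕ<; toℕ<n; toℕ-inject₁; toℕ-fromℕ) renaming (_≟_ to _≟ᶠ_)
open import Data.Fin.Subset using (_∈_; _-_)
open import Data.Fin.Subset.Properties using (x∈p∧x∉q⇒x∈p─q; x≢y⇒x∉⁅y⁆; x∈p⇒∣p-x∣<∣p∣)
open import Data.List.Base using ([]; _∷_)
open import Data.Product using (_×_; _,_; proj₁; proj₂; ∃-syntax; Σ-syntax)
open import Data.Product.Properties using (,-injectiveˡ; ,-injectiveʳ)
open import Data.Empty using (⊥-elim)
open import Data.Sum using (_⊎_; inj₁; inj₂; [_,_]′)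
open import Function using (_∘_)
open import Function.Definitions using (Injective)
open import Level using (0ℓ)
open import Relation.Nullary using (¬_; Dec; yes; no; contradiction; ¬?)
open import Relation.Nullary.Decidable using (decidable-stable)
open import Relation.Unary using (Pred; Decidable)
open import Relation.Binary using (tri<; tri≈; tri>)
open import Relation.Binary.PropositionalEquality

[m+d]%n≡m%n⇒d≡0 : ∀ m {d n} .{{_ : NonZero n}} → d < n → (m + d) % n ≡ m % n → d ≡ 0
[m+d]%n≡m%n⇒d≡0 m {zero} _ _ = refl
[m+d]%n≡m%n⇒d≡0 m {d@(suc _)} {n} d<n eq = contradiction n∣d (>⇒∤ d<n)
  where
  open ≡-Reasoning
  m/n*n+d≡[m+d]/n*n : m / n * n + d ≡ (m + d) / n * n
  m/n*n+d≡[m+d]/n*n = +-cancelˡ-≡ (m % n) _ _ (begin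
    m % n + (m / n * n + d) ≡⟨ +-assoc (m % n) _ d ⟨
    m % n + m / n * n + d   ≡⟨ cong (_+ d) (m≡m%n+[m/n]*n m n) ⟨
    m + d                   ≡⟨ m≡m%n+[m/n]*n (m + d) n ⟩
    (m + d) % n + (m + d) / n * n ≡⟨ cong (_+ (m + d) / n * n) eq ⟩
    m % n + (m + d) / n * n ∎)
  n∣d : n ∣ d
  n∣d = ∣m+n∣m⇒∣n (subst (n ∣_) (sym m/n*n+d≡[m+d]/n*n) (n∣m*n ((m + d) / n))) (n∣m*n (m / n))

[s+i]%n≡[s+j]%n⇒i≡j : ∀ s {i j n} .{{_ : NonZero n}} → i < n → j < n → (s + i) % n ≡ (s + j) % n → i ≡ j
[s+i]%n≡[s+j]%n⇒i≡j s {i} {j} {n} i<n j<n eq =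
  [ (λ i≤j → ordered i≤j j<n eq) , (λ j≤i → sym (ordered j≤i i<n (sym eq))) ]′ (≤-total i j)
  where
  ordered : ∀ {i j} → i ≤ j → j < n → (s + i) % n ≡ (s + j) % n → i ≡ j
  ordered {i} {j} i≤j j<n eq = ≤-antisym i≤j (m∸n≡0⇒m≤n j∸i≡0)
    where
    j∸i≡0 : j ∸ i ≡ 0
    j∸i≡0 = [m+d]%n≡m%n⇒d≡0 (s + i) (≤-<-trans (m∸n≤m j i) j<n)
      (trans (cong (_% n) (trans (+-assoc s i (j ∸ i)) (cong (s +_) (m+[n∸m]≡n i≤j)))) (sym eq))

[1+m]%n≡[1+m%n]%n : ∀ m n .{{_ : NonZero n}} → suc m % n ≡ suc (m % n) % n
[1+m]%n≡[1+m%n]%n m n = begin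
  suc m % n                       ≡⟨ cong (λ x → suc x % n) (m≡m%n+[m/n]*n m n) ⟩
  (suc (m % n) + m / n * n) % n   ≡⟨ [m+kn]%n≡m%n (suc (m % n)) (m / n) n ⟩
  suc (m % n) % n                 ∎
  where open ≡-Reasoning

toℕ-mod : ∀ m n .{{_ : NonZero n}} → toℕ (m mod n) ≡ m % n
toℕ-mod m n = toℕ-fromℕ< (m%n<n m n)

least-witness : ∀ {P : Pred ℕ 0ℓ} → Decidable P → ∀ {N} → P N →
                ∃[ s ] s ≤ N × P s × (∀ {r} → r < s → ¬ P r)
least-witness P? {N} pN with P? 0
... | yes p0 = 0 , z≤n , p0 , λ ()
least-witness P? {zero}  pN | no ¬p0 = contradiction pN ¬p0
least-witness P? {suc N} pN | no ¬p0 with least-witness (P? ∘ suc) pN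
... | s , s≤N , ps , below = suc s , s≤s s≤N , ps , λ { {zero} _ → ¬p0 ; {suc r} r<s → below (≤-pred r<s) }

injective⇒≤∣p∣ : ∀ {m} (p : Subset m) (f : ℕ → Fin m) q → (∀ {i} → i < q → f i ∈ p) →
                 (∀ {i j} → i < q → j < q → f i ≡ f j → i ≡ j) → q ≤ ∣ p ∣
injective⇒≤∣p∣ p f zero    _   _     = z≤n
injective⇒≤∣p∣ p f (suc q) f∈p f-inj = ≤-trans (s≤s q≤∣p-fq∣) (x∈p⇒∣p-x∣<∣p∣ (f∈p ≤-refl))
  where
  q≤∣p-fq∣ : q ≤ ∣ p - f q ∣
  q≤∣p-fq∣ = injective⇒≤∣p∣ (p - f q) f q
    (λ i<q → x∈p∧x∉q⇒x∈p─q (f∈p (m<n⇒m<1+n i<q))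
               (x≢y⇒x∉⁅y⁆ λ fi≡fq → <-irrefl (f-inj (m<n⇒m<1+n i<q) ≤-refl fi≡fq) i<q))
    (λ i<q j<q → f-inj (m<n⇒m<1+n i<q) (m<n⇒m<1+n j<q))

record Cyclic {A : Set} (L : ℕ) (f : ℕ → A) : Set where
  field
    periodic  : ∀ i → f (i + L) ≡ f i
    injective : ∀ s {i j} → i < L → j < L → f (s + i) ≡ f (s + j) → i ≡ j

module _ {A : Set} {L : ℕ} .{{_ : NonZero L}} {f : ℕ → A} (cyc : Cyclic L f) where
  open Cyclic cyc

  periodic-* : ∀ t x → f (x + t * L) ≡ f x
  periodic-* zero    x = cong f (+-identityʳ x)
  periodic-* (suc t) x = begin
    f (x + (L + t * L)) ≡⟨ cong f (trans (cong (x +_) (+-comm L (t * L))) (sym (+-assoc x (t * L) L))) ⟩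
    f (x + t * L + L)   ≡⟨ periodic (x + t * L) ⟩
    f (x + t * L)       ≡⟨ periodic-* t x ⟩
    f x                 ∎
    where open ≡-Reasoning

  periodic-% : ∀ x → f (x % L) ≡ f x
  periodic-% x = trans (sym (periodic-* (x / L) (x % L))) (cong f (sym (m≡m%n+[m/n]*n x L)))

  recurs-after : ∀ s x → ∃[ σ ] f (s + σ) ≡ f x
  recurs-after s x = x + s * L ∸ s , trans (cong f (m+[n∸m]≡n s≤x+sL)) (periodic-* s x)
    where
    s≤x+sL : s ≤ x + s * L
    s≤x+sL = ≤-trans (m≤m*n s L) (m≤n+m (s * L) x)

  in-window : ∀ {x a} → f x ≡ a → ∃[ i ] i < L × f i ≡ a
  in-window {x} fx≡a = x % L , m%n<n x L , trans (periodic-% x) fx≡a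

  any? : ∀ {P : Pred A 0ℓ} → Decidable P → Dec (∃[ i ] P (f i))
  any? {P} P? with anyUpTo? (P? ∘ f) L
  ... | yes (i , _ , p) = yes (i , p)
  ... | no  none        = no λ (x , p) → none (x % L , m%n<n x L , subst P (sym (periodic-% x)) p)

  rotate-cyclic : ∀ s → Cyclic L (λ i → f (s + i))
  rotate-cyclic s = record
    { periodic  = λ i → trans (cong f (sym (+-assoc s i L))) (periodic (s + i))
    ; injective = λ t {i} {j} i<L j<L eq → injective (s + t) i<L j<L
        (trans (cong f (+-assoc s t i)) (trans eq (cong f (sym (+-assoc s t j)))))
    }

mod-cyclic : ∀ {A : Set} {L} .{{_ : NonZero L}} (g : Fin L → A) → Injective _≡_ _≡_ g →
             Cyclic L (λ i → g (i mod L))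
mod-cyclic {L = L} g g-inj = record
  { periodic  = λ i → cong g (toℕ-injective (trans (toℕ-mod (i + L) L) (trans ([m+n]%n≡m%n i L) (sym (toℕ-mod i L)))))
  ; injective = λ s {i} {j} i<L j<L eq → [s+i]%n≡[s+j]%n⇒i≡j s i<L j<L
      (trans (sym (toℕ-mod (s + i) L)) (trans (cong toℕ (g-inj eq)) (toℕ-mod (s + j) L)))
  }

data Split (x : ℕ) : ℕ → Set where
  left  : ∀ {i} → i < x → Split x i
  right : ∀ j → Split x (x + j)

split : ∀ x i → Split x i
split x i with i <? x
... | yes i<x = left i<x
... | no  i≮x = subst (Split x) (m+[n∸m]≡n (≮⇒≥ i≮x)) (right (i ∸ x))

splice : ∀ {A : Set} → ℕ → (ℕ → A) → (ℕ → A) → ℕ → A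
splice x f g i with i <? x
... | yes _ = f i
... | no  _ = g (i ∸ x)

module Splice {A : Set} (x : ℕ) (f g : ℕ → A) where

  splice-< : ∀ {i} → i < x → splice x f g i ≡ f i
  splice-< {i} i<x with i <? x
  ... | yes _   = refl
  ... | no  i≮x = contradiction i<x i≮x

  splice-+ : ∀ j → splice x f g (x + j) ≡ g j
  splice-+ j with x + j <? x
  ... | yes x+j<x = contradiction x+j<x (≤⇒≯ (m≤m+n x j))
  ... | no  _     = cong g (m+n∸m≡n x j)

  splice-injective : ∀ {y} → (∀ {i j} → i < x → j < x → f i ≡ f j → i ≡ j) →
                     (∀ {i j} → i < y → j < y → g i ≡ g j → i ≡ j) →
                     (∀ {i j} → i < x → j < y → f i ≢ g j) →
                     ∀ {i j} → i < x + y → j < x + y → splice x f g i ≡ splice x f g j → i ≡ j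
  splice-injective {y} f-inj g-inj f≢g {i} {j} i<x+y j<x+y eq with split x i | split x j
  ... | left i<x | left j<x = f-inj i<x j<x (trans (sym (splice-< i<x)) (trans eq (splice-< j<x)))
  ... | left i<x | right j′ = contradiction (trans (sym (splice-< i<x)) (trans eq (splice-+ j′)))
                                              (f≢g i<x (+-cancelˡ-< x _ _ j<x+y))
  ... | right i′ | left j<x = contradiction (trans (sym (splice-< j<x)) (trans (sym eq) (splice-+ i′)))
                                              (f≢g j<x (+-cancelˡ-< x _ _ i<x+y))
  ... | right i′ | right j′ = cong (x +_) (g-inj (+-cancelˡ-< x _ _ i<x+y) (+-cancelˡ-< x _ _ j<x+y)
                                (trans (sym (splice-+ i′)) (trans eq (splice-+ j′))))

girth-arithmetic : ∀ {ℓ q y₁ y₂ L} → ℓ ≤ q + y₁ → ℓ ≤ q + y₂ → y₁ + y₂ ≡ L →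
                   100 * L ≤ 101 * ℓ → ℓ ≤ 5 * q
girth-arithmetic {ℓ} {q} {y₁} {y₂} {L} ℓ≤q+y₁ ℓ≤q+y₂ y₁+y₂≡L 100L≤101ℓ = *-cancelˡ-≤ 99 (begin
  99 * ℓ       ≤⟨ +-cancelʳ-≤ (101 * ℓ) (99 * ℓ) (200 * q) 99ℓ+101ℓ≤200q+101ℓ ⟩
  200 * q      ≤⟨ *-monoˡ-≤ q (m≤m+n 200 295) ⟩
  495 * q      ≡⟨ *-assoc 99 5 q ⟩
  99 * (5 * q) ∎)
  where
  open ≤-Reasoning
  99ℓ+101ℓ≤200q+101ℓ : 99 * ℓ + 101 * ℓ ≤ 200 * q + 101 * ℓ
  99ℓ+101ℓ≤200q+101ℓ = begin
    99 * ℓ + 101 * ℓ             ≡⟨ solve (ℓ ∷ []) ⟩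
    100 * (ℓ + ℓ)                ≤⟨ *-monoʳ-≤ 100 (+-mono-≤ ℓ≤q+y₁ ℓ≤q+y₂) ⟩
    100 * ((q + y₁) + (q + y₂))  ≡⟨ solve (q ∷ y₁ ∷ y₂ ∷ []) ⟩
    200 * q + 100 * (y₁ + y₂)    ≡⟨ cong (λ y → 200 * q + 100 * y) y₁+y₂≡L ⟩
    200 * q + 100 * L            ≤⟨ +-monoʳ-≤ (200 * q) 100L≤101ℓ ⟩
    200 * q + 101 * ℓ            ∎

module _ {n m : ℕ} (G : Graph n m) where

  Joins-sym : ∀ {e u v} → Joins G e u v → Joins G e v u
  Joins-sym (inj₁ eq) = inj₂ eq
  Joins-sym (inj₂ eq) = inj₁ eq

  Joins-ends : ∀ {e a b c d} → Joins G e a b → Joins G e c d → (a ≡ c × b ≡ d) ⊎ (a ≡ d × b ≡ c)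
  Joins-ends (inj₁ p) (inj₁ q) = inj₁ (,-injectiveˡ (trans (sym p) q) , ,-injectiveʳ (trans (sym p) q))
  Joins-ends (inj₁ p) (inj₂ q) = inj₂ (,-injectiveˡ (trans (sym p) q) , ,-injectiveʳ (trans (sym p) q))
  Joins-ends (inj₂ p) (inj₁ q) = inj₂ (,-injectiveʳ (trans (sym p) q) , ,-injectiveˡ (trans (sym p) q))
  Joins-ends (inj₂ p) (inj₂ q) = inj₁ (,-injectiveʳ (trans (sym p) q) , ,-injectiveˡ (trans (sym p) q))

  Loopless : Set
  Loopless = ∀ e → proj₁ (ends G e) ≢ proj₂ (ends G e)

  loopless⇒¬Joins-loop : Loopless → ∀ {e v} → ¬ Joins G e v v
  loopless⇒¬Joins-loop loopless {e} (inj₁ eq) = loopless e (trans (cong proj₁ eq) (sym (cong proj₂ eq)))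
  loopless⇒¬Joins-loop loopless {e} (inj₂ eq) = loopless e (trans (cong proj₁ eq) (sym (cong proj₂ eq)))

  cycle-joins : (c : Cycle G) (x y : Fin (len c)) → toℕ y ≡ suc (toℕ x) % len c →
                Joins G (edg c x) (vtx c x) (vtx c y)
  cycle-joins c x y y≡x+1 with m≤n⇒m<n∨m≡n (≤-pred (toℕ<n x))
  ... | inj₁ x<k = subst₂ (λ x y → Joins G (edg c x) (vtx c x) (vtx c y)) t≡x t+1≡y (step c t)
    where
    t = fromℕ< x<k
    t≡x : inject₁ t ≡ x
    t≡x = toℕ-injective (trans (toℕ-inject₁ t) (toℕ-fromℕ< x<k))
    t+1≡y : Fin.suc t ≡ y
    t+1≡y = toℕ-injective (trans (cong suc (toℕ-fromℕ< x<k)) (sym (trans y≡x+1 (m<n⇒m%n≡m (s≤s x<k)))))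
  ... | inj₂ x≡k = subst₂ (λ x y → Joins G (edg c x) (vtx c x) (vtx c y)) k≡x 0≡y (close c)
    where
    k≡x : fromℕ (k c) ≡ x
    k≡x = toℕ-injective (trans (toℕ-fromℕ (k c)) (sym x≡k))
    0≡y : Fin.zero ≡ y
    0≡y = toℕ-injective (sym (trans y≡x+1 (trans (cong (λ i → suc i % len c) x≡k) (n%n≡0 (len c)))))

  -- A cycle of length K + 1 unrolled into a (K + 1)-periodic walk on ℕ, so that positions along
  -- it never need reducing modulo the length.
  record PeriodicCycle : Set where
    field
      K        : ℕ
      V        : ℕ → Fin n
      E        : ℕ → Fin m
      joins    : ∀ i → Joins G (E i) (V i) (V (suc i))
      V-cyclic : Cyclic (suc K) V
      E-cyclic : Cyclic (suc K) E

  open PeriodicCycle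

  OnV : PeriodicCycle → Fin n → Set
  OnV C v = ∃[ i ] V C i ≡ v

  OnE : PeriodicCycle → Fin m → Set
  OnE C e = ∃[ i ] E C i ≡ e

  unroll : Cycle G → PeriodicCycle
  unroll c = record
    { K        = k c
    ; V        = λ i → vtx c (i mod len c)
    ; E        = λ i → edg c (i mod len c)
    ; joins    = λ i → cycle-joins c (i mod len c) (suc i mod len c) (begin
                   toℕ (suc i mod len c)      ≡⟨ toℕ-mod (suc i) (len c) ⟩
                   suc i % len c              ≡⟨ [1+m]%n≡[1+m%n]%n i (len c) ⟩
                   suc (i % len c) % len c    ≡⟨ cong (λ r → suc r % len c) (toℕ-mod i (len c)) ⟨
                   suc (toℕ (i mod len c)) % len c ∎)
    ; V-cyclic = mod-cyclic (vtx c) (vtx-inj c)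
    ; E-cyclic = mod-cyclic (edg c) (edg-inj c)
    }
    where open ≡-Reasoning

  InCycle⇒OnE : ∀ (c : Cycle G) {e} → InCycle c e → OnE (unroll c) e
  InCycle⇒OnE c (x , x↦e) = toℕ x , trans (cong (edg c) x′≡x) x↦e
    where
    x′≡x : toℕ x mod len c ≡ x
    x′≡x = toℕ-injective (trans (toℕ-mod (toℕ x) (len c)) (m<n⇒m%n≡m (toℕ<n x)))

  OnE⇒InCycle : ∀ (c : Cycle G) {e} → OnE (unroll c) e → InCycle c e
  OnE⇒InCycle c (i , i↦e) = i mod len c , i↦e

  rotate : PeriodicCycle → ℕ → PeriodicCycle
  rotate C s = record
    { K        = K C
    ; V        = λ i → V C (s + i)
    ; E        = λ i → E C (s + i)
    ; joins    = λ i → subst (Joins G (E C (s + i)) (V C (s + i))) (cong (V C) (sym (+-suc s i)))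
                           (joins C (s + i))
    ; V-cyclic = rotate-cyclic (V-cyclic C) s
    ; E-cyclic = rotate-cyclic (E-cyclic C) s
    }

  record Path (a b : Fin n) : Set where
    field
      length           : ℕ
      vertex           : ℕ → Fin n
      edge             : ℕ → Fin m
      joins            : ∀ {i} → i < length → Joins G (edge i) (vertex i) (vertex (suc i))
      start            : vertex 0 ≡ a
      end              : vertex length ≡ b
      vertex-injective : ∀ {i j} → i ≤ length → j ≤ length → vertex i ≡ vertex j → i ≡ j
      edge-injective   : ∀ {i j} → i < length → j < length → edge i ≡ edge j → i ≡ j

  open Path

  retarget : ∀ {a b a′ b′} → a ≡ a′ → b ≡ b′ → Path a b → Path a′ b′
  retarget a≡a′ b≡b′ P = record
    { length = length P ; vertex = vertex P ; edge = edge P ; joins = joins P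
    ; start = trans (start P) a≡a′ ; end = trans (end P) b≡b′
    ; vertex-injective = vertex-injective P ; edge-injective = edge-injective P
    }

  reverse : ∀ {a b} → Path a b → Path b a
  reverse P = record
    { length           = x
    ; vertex           = λ i → vertex P (x ∸ i)
    ; edge             = λ i → edge P (x ∸ suc i)
    ; joins            = λ i<x → Joins-sym (subst (Joins G (edge P _) (vertex P _))
                                              (cong (vertex P) (sym (+-∸-assoc 1 i<x))) (joins P (x∸1+i<x i<x)))
    ; start            = end P
    ; end              = trans (cong (vertex P) (n∸n≡0 x)) (start P)
    ; vertex-injective = λ {i} {j} i≤x j≤x eq →
                           ∸-cancelˡ-≡ i≤x j≤x (vertex-injective P (m∸n≤m x i) (m∸n≤m x j) eq)
    ; edge-injective   = λ i<x j<x eq →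
                           suc-injective (∸-cancelˡ-≡ i<x j<x (edge-injective P (x∸1+i<x i<x) (x∸1+i<x j<x) eq))
    }
    where
    x = length P
    x∸1+i<x : ∀ {i} → i < x → x ∸ suc i < x
    x∸1+i<x i<x = ∸-monoʳ-< z<s i<x

  arc : (C : PeriodicCycle) (s y : ℕ) → y < suc (K C) → Path (V C s) (V C (s + y))
  arc C s y y<L = record
    { length           = y
    ; vertex           = V C′
    ; edge             = E C′
    ; joins            = λ {i} _ → joins C′ i
    ; start            = cong (V C) (+-identityʳ s)
    ; end              = refl
    ; vertex-injective = λ i≤y j≤y → Cyclic.injective (V-cyclic C) s (≤-<-trans i≤y y<L) (≤-<-trans j≤y y<L)
    ; edge-injective   = λ i<y j<y → Cyclic.injective (E-cyclic C) s (<-trans i<y y<L) (<-trans j<y y<L)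
    }
    where
    C′ = rotate C s

  closed-walk⇒cycle : ∀ {L} (W : ℕ → Fin n) (F : ℕ → Fin m) → 0 < L →
    (∀ {i} → i < L → Joins G (F i) (W i) (W (suc i))) → W L ≡ W 0 →
    (∀ {i j} → i < L → j < L → W i ≡ W j → i ≡ j) →
    (∀ {i j} → i < L → j < L → F i ≡ F j → i ≡ j) → Σ[ c ∈ Cycle G ] len c ≡ L
  closed-walk⇒cycle {suc K} W F _ W-joins closes W-inj F-inj = record
    { k       = K
    ; vtx     = W ∘ toℕ
    ; edg     = F ∘ toℕ
    ; vtx-inj = λ {i} {j} eq → toℕ-injective (W-inj (toℕ<n i) (toℕ<n j) eq)
    ; edg-inj = λ {i} {j} eq → toℕ-injective (F-inj (toℕ<n i) (toℕ<n j) eq)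
    ; step    = λ i → subst (λ r → Joins G (F r) (W r) (W (suc (toℕ i)))) (sym (toℕ-inject₁ i))
                        (W-joins (m<n⇒m<1+n (toℕ<n i)))
    ; close   = subst (λ r → Joins G (F r) (W r) (W 0)) (sym (toℕ-fromℕ K))
                  (subst (Joins G (F K) (W K)) closes (W-joins ≤-refl))
    } , refl

  Along : PeriodicCycle → ∀ {a b} → Path a b → Set
  Along C P = (∀ i → OnV C (vertex P i)) × (∀ i → OnE C (edge P i))

  Avoids : PeriodicCycle → ∀ {a b} → Path a b → Set
  Avoids C P = (∀ {i} → 0 < i → i < length P → ¬ OnV C (vertex P i))
             × (∀ {i} → i < length P → ¬ OnE C (edge P i))

  close-up : ∀ {C a b} (P : Path a b) (Q : Path b a) → 0 < length P → Avoids C P → Along C Q →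
             Σ[ c ∈ Cycle G ] len c ≡ length P + length Q
  close-up {C} P Q 0<x (P-interior-off , P-edges-off) (Q-vertices-on , Q-edges-on) =
    closed-walk⇒cycle W F (<-≤-trans 0<x (m≤m+n x y)) W-joins closes
      (W.splice-injective P-vertex-injective Q-vertex-injective vertices-disjoint)
      (F.splice-injective (edge-injective P) (edge-injective Q)
        (λ i<x _ Pi≡Qj → P-edges-off i<x (subst (OnE C) (sym Pi≡Qj) (Q-edges-on _))))
    where
    x = length P
    y = length Q
    module W = Splice x (vertex P) (vertex Q)
    module F = Splice x (edge P) (edge Q)
    W = splice x (vertex P) (vertex Q)
    F = splice x (edge P) (edge Q)

    W≡P : ∀ {i} → i ≤ x → W i ≡ vertex P i
    W≡P {i} i≤x with m≤n⇒m<n∨m≡n i≤x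
    ... | inj₁ i<x = W.splice-< i<x
    ... | inj₂ refl = trans (cong W (sym (+-identityʳ x))) (trans (W.splice-+ 0) (trans (start Q) (sym (end P))))

    W-joins : ∀ {i} → i < x + y → Joins G (F i) (W i) (W (suc i))
    W-joins {i} i<x+y with split x i
    ... | left i<x = subst₂ (Joins G (F i)) (sym (W≡P (<⇒≤ i<x))) (sym (W≡P i<x))
                       (subst (λ e → Joins G e _ _) (sym (F.splice-< i<x)) (joins P i<x))
    ... | right j  = subst₂ (Joins G (F (x + j)))
                       (sym (W.splice-+ j)) (sym (trans (cong W (sym (+-suc x j))) (W.splice-+ (suc j))))
                       (subst (λ e → Joins G e _ _) (sym (F.splice-+ j)) (joins Q (+-cancelˡ-< x _ _ i<x+y)))

    closes : W (x + y) ≡ W 0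
    closes = trans (W.splice-+ y) (trans (end Q) (trans (sym (start P)) (sym (W≡P z≤n))))

    P-vertex-injective : ∀ {i j} → i < x → j < x → vertex P i ≡ vertex P j → i ≡ j
    P-vertex-injective i<x j<x = vertex-injective P (<⇒≤ i<x) (<⇒≤ j<x)

    Q-vertex-injective : ∀ {i j} → i < y → j < y → vertex Q i ≡ vertex Q j → i ≡ j
    Q-vertex-injective i<y j<y = vertex-injective Q (<⇒≤ i<y) (<⇒≤ j<y)

    vertices-disjoint : ∀ {i j} → i < x → j < y → vertex P i ≢ vertex Q j
    vertices-disjoint {zero} {j} _ j<y P0≡Qj = <-irrefl
      (vertex-injective Q (<⇒≤ j<y) ≤-refl (trans (sym P0≡Qj) (trans (start P) (sym (end Q))))) j<y
    vertices-disjoint {suc i} s<x _ Pi≡Qj = P-interior-off z<s s<x (subst (OnV C) (sym Pi≡Qj) (Q-vertices-on _))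

  arc-along : ∀ C s y (y<L : y < suc (K C)) → Along C (arc C s y y<L)
  arc-along C s y y<L = (λ i → s + i , refl) , (λ i → s + i , refl)

  Arcs : PeriodicCycle → Fin n → Fin n → Set
  Arcs C a b = Σ[ P ∈ Path a b ] Σ[ Q ∈ Path b a ] Along C P × Along C Q × length P + length Q ≡ suc (K C)

  swap-arcs : ∀ {C a b} → Arcs C a b → Arcs C b a
  swap-arcs {C} (P , Q , P-along , Q-along , sum) = Q , P , Q-along , P-along , trans (+-comm (length Q) (length P)) sum

  complementary-arcs : ∀ C {u v a b} → u < v → v < suc (K C) → V C u ≡ a → V C v ≡ b → Arcs C a b
  complementary-arcs C {u} {v} u<v v<L Vu≡a Vv≡b =
    retarget Vu≡a (trans (cong (V C) u+d≡v) Vv≡b) (arc C u d d<L) ,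
    retarget (trans (cong (V C) u+d≡v) Vv≡b) (trans back Vu≡a) (arc C (u + d) (L ∸ d) L∸d<L) ,
    arc-along C u d d<L , arc-along C (u + d) (L ∸ d) L∸d<L , m+[n∸m]≡n (<⇒≤ d<L)
    where
    L = suc (K C)
    d = v ∸ u
    u+d≡v : u + d ≡ v
    u+d≡v = m+[n∸m]≡n (<⇒≤ u<v)
    d<L : d < L
    d<L = ≤-<-trans (m∸n≤m v u) v<L
    L∸d<L : L ∸ d < L
    L∸d<L = ∸-monoʳ-< (m<n⇒0<n∸m u<v) (<⇒≤ d<L)
    back : V C (u + d + (L ∸ d)) ≡ V C u
    back = trans (cong (V C) (trans (+-assoc u d (L ∸ d)) (cong (u +_) (m+[n∸m]≡n (<⇒≤ d<L)))))
                 (Cyclic.periodic (V-cyclic C) u)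

  arcs-between : ∀ C {a b} → OnV C a → OnV C b → a ≢ b → Arcs C a b
  arcs-between C (_ , Vx≡a) (_ , Vy≡b) a≢b
    with in-window (V-cyclic C) Vx≡a | in-window (V-cyclic C) Vy≡b
  ... | α , α<L , Vα≡a | β , β<L , Vβ≡b with <-cmp α β
  ... | tri< α<β _ _ = complementary-arcs C α<β β<L Vα≡a Vβ≡b
  ... | tri≈ _ α≡β _ = contradiction (trans (sym Vα≡a) (trans (cong (V C) α≡β) Vβ≡b)) a≢b
  ... | tri> _ _ β<α = swap-arcs {C} (complementary-arcs C β<α α<L Vβ≡b Vα≡a)

  onV? : ∀ C v → Dec (OnV C v)
  onV? C v = any? (V-cyclic C) (_≟ᶠ v)

  onE? : ∀ C e → Dec (OnE C e)
  onE? C e = any? (E-cyclic C) (_≟ᶠ e)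

  OnE⇒OnV : ∀ {C e u v} → OnE C e → Joins G e u v → OnV C u × OnV C v
  OnE⇒OnV {C} (i , Ei≡e) e-joins with Joins-ends (subst (λ e → Joins G e _ _) Ei≡e (joins C i)) e-joins
  ... | inj₁ (Vi≡u , Vi+1≡v) = (i , Vi≡u) , (suc i , Vi+1≡v)
  ... | inj₂ (Vi≡v , Vi+1≡u) = (suc i , Vi+1≡u) , (i , Vi≡v)

  loopless⇒K≢0 : Loopless → ∀ D → K D ≢ 0
  loopless⇒K≢0 loopless D K≡0 =
    loopless⇒¬Joins-loop loopless (subst (Joins G (E D 0) (V D 0)) V1≡V0 (joins D 0))
    where
    V1≡V0 : V D 1 ≡ V D 0
    V1≡V0 = trans (cong (λ k → V D (suc k)) (sym K≡0)) (Cyclic.periodic (V-cyclic D) 0)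

  -- Let ρ be the first position of C whose vertex lies on D, say at D-position j. Both D-edges
  -- at j are C-edges at V C ρ other than E C K, and minimality of ρ forces both to be E C ρ.
  edges-⊆⇒last-edge-on : Loopless → ∀ D C → (∀ i → OnE C (E D i)) → ¬ ¬ OnE D (E C (K C))
  edges-⊆⇒last-edge-on loopless D C D⊆C last-off
    with in-window (V-cyclic C) (proj₂ (proj₁ (OnE⇒OnV {C} (D⊆C 0) (joins D 0))))
  ... | ρ₀ , ρ₀<L , Vρ₀≡V0
    with least-witness (λ ρ → onV? D (V C ρ)) {ρ₀} (0 , sym Vρ₀≡V0)
  ... | ρ , ρ≤ρ₀ , (j , Vj≡Vρ) , off-before-ρ = loopless⇒K≢0 loopless D (sym 0≡K)
    where
    ρ<L : ρ < suc (K C)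
    ρ<L = ≤-<-trans ρ≤ρ₀ ρ₀<L

    edge-at-ρ : ∀ {e w} → OnE D e → OnE C e → Joins G e (V C ρ) w → OnV D w → e ≡ E C ρ
    edge-at-ρ e-on-D e-on-C e-joins w-on with in-window (E-cyclic C) (proj₂ e-on-C)
    ... | σ , σ<L , Eσ≡e with Joins-ends (subst (λ e → Joins G e _ _) Eσ≡e (joins C σ)) e-joins
    ... | inj₁ (Vσ≡Vρ , _) = trans (sym Eσ≡e) (cong (E C) (Cyclic.injective (V-cyclic C) 0 σ<L ρ<L Vσ≡Vρ))
    ... | inj₂ (Vσ≡w , Vσ+1≡Vρ) = contradiction (subst (OnV D) (sym Vσ≡w) w-on) (off-before-ρ σ<ρ)
      where
      σ<K : σ < K C
      σ<K = ≤∧≢⇒< (≤-pred σ<L) λ σ≡K → last-off (subst (OnE D) (trans (sym Eσ≡e) (cong (E C) σ≡K)) e-on-D)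
      σ<ρ : σ < ρ
      σ<ρ = ≤-reflexive (Cyclic.injective (V-cyclic C) 0 (s≤s σ<K) ρ<L Vσ+1≡Vρ)

    jK = j + K D
    Vj+K+1≡Vρ : V D (suc jK) ≡ V C ρ
    Vj+K+1≡Vρ = trans (cong (V D) (sym (+-suc j (K D)))) (trans (Cyclic.periodic (V-cyclic D) j) Vj≡Vρ)

    0≡K : 0 ≡ K D
    0≡K = Cyclic.injective (E-cyclic D) j z<s ≤-refl (begin
      E D (j + 0) ≡⟨ cong (E D) (+-identityʳ j) ⟩
      E D j       ≡⟨ edge-at-ρ (j , refl) (D⊆C j)
                       (subst (λ v → Joins G (E D j) v (V D (suc j))) Vj≡Vρ (joins D j)) (suc j , refl) ⟩
      E C ρ       ≡⟨ edge-at-ρ (jK , refl) (D⊆C jK)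
                       (Joins-sym (subst (Joins G (E D jK) _) Vj+K+1≡Vρ (joins D jK))) (jK , refl) ⟨
      E D jK      ∎)
      where open ≡-Reasoning

  edges-⊆⇒⊇ : Loopless → ∀ D C → (∀ i → OnE C (E D i)) → ∀ r → OnE D (E C r)
  edges-⊆⇒⊇ loopless D C D⊆C r with onE? D (E C r)
  ... | yes r-on = r-on
  ... | no  r-off = ⊥-elim (edges-⊆⇒last-edge-on loopless D C′ D⊆C′ (r-off ∘ subst (OnE D) last≡r))
    where
    C′ = rotate C (suc r)
    D⊆C′ : ∀ i → OnE C′ (E D i)
    D⊆C′ i with D⊆C i
    ... | x , Ex≡e with recurs-after (E-cyclic C) (suc r) x
    ... | σ , Eσ≡Ex = σ , trans Eσ≡Ex Ex≡e
    last≡r : E C′ (K C) ≡ E C r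
    last≡r = trans (cong (E C) (sym (+-suc r (K C)))) (Cyclic.periodic (E-cyclic C) r)

  reverse-along : ∀ {C a b} {P : Path a b} → Along C P → Along C (reverse P)
  reverse-along (vertices-on , edges-on) = (λ _ → vertices-on _) , (λ _ → edges-on _)

  record Detour (D C : PeriodicCycle) : Set where
    field
      base         : ℕ
      span         : ℕ
      0<span       : 0 < span
      span≤L       : span ≤ suc (K D)
      base-on      : OnV C (V D base)
      end-on       : OnV C (V D (base + span))
      interior-off : ∀ {i} → 0 < i → i < span → ¬ OnV C (V D (base + i))
      edges-off    : ∀ {i} → i < span → ¬ OnE C (E D (base + i))

  on-while-edges-on : ∀ {D C j} → OnV C (V D j) → ∀ s → (∀ {r} → r < s → ¬ ¬ OnE C (E D (j + r))) →
                      OnV C (V D (j + s))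
  on-while-edges-on {D} {C} {j} j-on zero    _       = subst (OnV C) (cong (V D) (sym (+-identityʳ j))) j-on
  on-while-edges-on {D} {C} {j} j-on (suc r) edges-on = subst (OnV C) (cong (V D) (sym (+-suc j r)))
    (proj₂ (OnE⇒OnV {C} (decidable-stable (onE? C _) (edges-on ≤-refl)) (joins D (j + r))))

  detour-exists : ∀ D C → ∃[ i ] ¬ OnE C (E D i) → ∃[ j ] OnV C (V D j) → Detour D C
  detour-exists D C (i₀ , i₀-off) (j₁ , j₁-on) with recurs-after (E-cyclic D) j₁ i₀
  ... | σ , Eσ≡Ei₀
    with least-witness (λ s → ¬? (onE? C (E D (j₁ + s)))) {σ} (i₀-off ∘ subst (OnE C) Eσ≡Ei₀)
  ... | s , _ , s-off , on-before-s with on-while-edges-on {D} {C} j₁-on s on-before-s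
  ... | j-on
    with least-witness (λ t → onV? C (V D (j₁ + s + suc t))) {K D}
           (subst (OnV C) (sym (Cyclic.periodic (V-cyclic D) (j₁ + s))) j-on)
  ... | t , t≤K , return-on , off-before-t = record
    { base         = j
    ; span         = suc t
    ; 0<span       = z<s
    ; span≤L       = s≤s t≤K
    ; base-on      = j-on
    ; end-on       = return-on
    ; interior-off = interior-off
    ; edges-off    = edges-off
    }
    where
    j = j₁ + s

    interior-off : ∀ {i} → 0 < i → i < suc t → ¬ OnV C (V D (j + i))
    interior-off {suc i} _ (s≤s i<t) = off-before-t i<t

    edges-off : ∀ {i} → i < suc t → ¬ OnE C (E D (j + i))
    edges-off {zero}  _   = s-off ∘ subst (OnE C) (cong (E D) (+-identityʳ j))
    edges-off {suc i} i<q on = interior-off z<s i<q (proj₁ (OnE⇒OnV {C} on (joins D (j + suc i))))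

  detour-bound : ∀ {D C ℓ} → (∀ c → ℓ ≤ len c) → ℓ ≤ suc (K D) → 100 * suc (K C) ≤ 101 * ℓ →
                 (T : Detour D C) → ℓ ≤ 5 * Detour.span T
  detour-bound {D} {C} {ℓ} girth ℓ≤L 100L≤101ℓ T with m≤n⇒m<n∨m≡n (Detour.span≤L T)
  ... | inj₂ q≡L = ≤-trans ℓ≤L (≤-trans (≤-reflexive (sym q≡L)) (m≤n*m _ 5))
  ... | inj₁ q<L = bound-from-arcs (arcs-between C base-on end-on ends-differ)
    where
    open Detour T
    P = arc D base span q<L

    ends-differ : V D base ≢ V D (base + span)
    ends-differ eq = <-irrefl
      (Cyclic.injective (V-cyclic D) base z<s q<L (trans (cong (V D) (+-identityʳ base)) eq)) 0<span

    girth-via : (Q : Path (V D (base + span)) (V D base)) → Along C Q → ℓ ≤ span + length Q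
    girth-via Q Q-along with close-up {C} P Q 0<span (interior-off , edges-off) Q-along
    ... | c , len≡ = subst (ℓ ≤_) len≡ (girth c)

    bound-from-arcs : Arcs C (V D base) (V D (base + span)) → ℓ ≤ 5 * span
    bound-from-arcs (Q₂ , Q₁ , Q₂-along , Q₁-along , sum) =
      girth-arithmetic {q = span} {length Q₂} {length Q₁}
        (girth-via (reverse Q₂) (reverse-along {C} {P = Q₂} Q₂-along)) (girth-via Q₁ Q₁-along) sum 100L≤101ℓ

  module _ (D C : Cycle G) (S : Subset m) (D⊆S∪C : ∀ e → InCycle D e → e ∈ S ⊎ InCycle C e) where

    off-C⇒∈S : ∀ i → ¬ OnE (unroll C) (E (unroll D) i) → E (unroll D) i ∈ S
    off-C⇒∈S i off with D⊆S∪C _ (i mod len D , refl)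
    ... | inj₁ ∈S = ∈S
    ... | inj₂ ∈C = contradiction (InCycle⇒OnE C ∈C) off

    off-C-window≤∣S∣ : ∀ s {q} → q ≤ len D → (∀ {i} → i < q → ¬ OnE (unroll C) (E (unroll D) (s + i))) →
                       q ≤ ∣ S ∣
    off-C-window≤∣S∣ s q≤L off = injective⇒≤∣p∣ S (λ i → E (unroll D) (s + i)) _
      (λ {i} i<q → off-C⇒∈S (s + i) (off i<q))
      (λ i<q j<q → Cyclic.injective (E-cyclic (unroll D)) s (<-≤-trans i<q q≤L) (<-≤-trans j<q q≤L))

    leaving-bound : ∀ {ℓ} → (∀ c → ℓ ≤ len c) → 100 * len C ≤ 101 * ℓ →
                    ∃[ i ] ¬ OnE (unroll C) (E (unroll D) i) → ℓ ≤ 5 * ∣ S ∣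
    leaving-bound girth 100L≤101ℓ leaving with any? (V-cyclic (unroll D)) (onV? (unroll C))
    ... | yes meets = ≤-trans (detour-bound girth (girth D) 100L≤101ℓ T)
                        (*-monoʳ-≤ 5 (off-C-window≤∣S∣ base span≤L edges-off))
      where
      T = detour-exists (unroll D) (unroll C) leaving meets
      open Detour T
    ... | no  avoids = ≤-trans (girth D) (≤-trans (off-C-window≤∣S∣ 0 ≤-refl all-off) (m≤n*m _ 5))
      where
      all-off : ∀ {i} → i < len D → ¬ OnE (unroll C) (E (unroll D) i)
      all-off {i} _ on = avoids (i , proj₁ (OnE⇒OnV {unroll C} on (joins (unroll D) i)))

  edges-⊆⇒SameEdges : Loopless → ∀ D C → (∀ i → OnE (unroll C) (E (unroll D) i)) → SameEdges D C
  edges-⊆⇒SameEdges loopless D C D⊆C e = D→C , C→D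
    where
    D→C : InCycle D e → InCycle C e
    D→C e∈D with InCycle⇒OnE D e∈D
    ... | i , i↦e = OnE⇒InCycle C (subst (OnE (unroll C)) i↦e (D⊆C i))
    C→D : InCycle C e → InCycle D e
    C→D e∈C with InCycle⇒OnE C e∈C
    ... | r , r↦e = OnE⇒InCycle D (subst (OnE (unroll D)) r↦e (edges-⊆⇒⊇ loopless (unroll D) (unroll C) D⊆C r))

claim4p4 : ∀ {n m} (G : Graph n m) → Simple G → (ℓ : ℕ) → IsGirth G ℓ
         → (C : Cycle G) → ℓ ≤ len C → 100 * len C ≤ 101 * ℓ
         → (S : Subset m) → IsCycleOfContr C S
         → ℓ ≤ 5 * ∣ S ∣
claim4p4 G (loopless , _) ℓ (_ , girth) C _ 100L≤101ℓ S (_ , (D , D≉C , D⊆S∪C) , _)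
  with any? (PeriodicCycle.E-cyclic (unroll G D)) (¬? ∘ onE? G (unroll G C))
... | yes leaving = leaving-bound G D C S D⊆S∪C girth 100L≤101ℓ leaving
... | no  staying = contradiction
        (edges-⊆⇒SameEdges G loopless D C λ i →
          decidable-stable (onE? G (unroll G C) _) (λ off → staying (i , off)))
        D≉C
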